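{- Let $G$ be a connected simple graph with a fixed total order on its edges, and let $T_1<T_2<\dots<T_k$ be its NBC spanning trees in lexicographic order. Let $S\subseteq E(G)$ with $S\in[\mathcal{R}(T_i),T_i]$ and let $e\in E(G)$ be such that $S\cup\{e\}\in[\mathcal{R}(T_j),T_j]$. Then $j\ge i$.
   Context: A broken circuit is the edge set of a cycle minus its smallest edge; an NBC spanning tree is a spanning tree whose edge set contains no broken circuit. Spanning trees are written as increasing tuples of their edges and compared lexicographically. For $1\le i\le k$, $\mathcal{R}(T_i)=\{x\in E(T_i): E(T_i)\setminus\{x\}\subseteq E(T_l)\text{ for some } l<i\}$. For edge sets $A\subseteq B$, $[A,B]$ denotes the set of edge sets $S$ with $A\subseteq S\subseteq B$ (identifying trees with their edge sets). -}

module Defs where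

open import Data.Nat using (ℕ; zero; suc)
open import Data.Fin as F using (Fin; inject₁; fromℕ)
open import Data.Fin.Subset using (Subset; _∈_; _∉_; _⊆_; _-_)
open import Data.Fin.Subset.Properties using (_∈?_)
open import Data.List using (List; filter; allFin)
open import Data.List.Relation.Binary.Lex.Strict using (Lex-<)
open import Data.Product using (Σ; ∃; ∃-syntax; _×_; _,_; proj₁; proj₂)
open import Data.Sum using (_⊎_)
open import Function using (Injective)
open import Relation.Binary.PropositionalEquality using (_≡_; _≢_)
open import Relation.Nullary using (¬_)

-- Vertices are Fin n, edges are Fin m; the total order on edges is the
-- natural order of Fin m (any total order on a finite set is of this form
-- after relabelling the edges).

record Graph : Set where
  field
    n m   : ℕ
    ends  : Fin m → Fin n × Fin n
    loopless : ∀ e → proj₁ (ends e) ≢ proj₂ (ends e)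

  Joins : Fin m → Fin n → Fin n → Set
  Joins e u v = ends e ≡ (u , v) ⊎ ends e ≡ (v , u)

  field
    noMulti : ∀ e f → Joins f (proj₁ (ends e)) (proj₂ (ends e)) → e ≡ f

  EdgeSet : Set
  EdgeSet = Subset m

  data Walk (F : EdgeSet) : Fin n → Fin n → Set where
    here : ∀ {u} → Walk F u u
    step : ∀ {u w v} (e : Fin m) → e ∈ F → Joins e u w → Walk F w v → Walk F u v

  Connected : EdgeSet → Set
  Connected F = ∀ u v → Walk F u v

  -- C is the edge set of a cycle: a cyclic sequence of k+3 distinct
  -- vertices v_0,…,v_{k+2} and distinct edges e_0,…,e_{k+2}, where e_i
  -- joins v_i and v_{i+1} (indices mod k+3); C = {e_0,…,e_{k+2}}.
  record CycleData (C : EdgeSet) : Set where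
    field
      k   : ℕ
      vs  : Fin (suc (suc (suc k))) → Fin n
      es  : Fin (suc (suc (suc k))) → Fin m
      vs-inj : Injective _≡_ _≡_ vs
      es-inj : Injective _≡_ _≡_ es
      es-join : ∀ (i : Fin (suc (suc k))) → Joins (es (inject₁ i)) (vs (inject₁ i)) (vs (F.suc i))
      es-close : Joins (es (fromℕ (suc (suc k)))) (vs (fromℕ (suc (suc k)))) (vs F.zero)
      es-set : ∀ x → x ∈ C → ∃[ i ] es i ≡ x
      set-es : ∀ i → es i ∈ C

  IsCycle : EdgeSet → Set
  IsCycle C = CycleData C

  BrokenCircuit : EdgeSet → Set
  BrokenCircuit B = ∃[ C ] IsCycle C × ∃[ x ] (x ∈ C × (∀ y → y ∈ C → x F.≤ y) × B ≡ C - x)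

  Acyclic : EdgeSet → Set
  Acyclic T = ¬ (∃[ C ] IsCycle C × C ⊆ T)

  IsSpanningTree : EdgeSet → Set
  IsSpanningTree T = Connected T × Acyclic T

  IsNBC : EdgeSet → Set
  IsNBC T = IsSpanningTree T × ¬ (∃[ B ] BrokenCircuit B × B ⊆ T)

  edgeList : EdgeSet → List (Fin m)
  edgeList T = filter (_∈? T) (allFin m)

  _<lex_ : EdgeSet → EdgeSet → Set
  S <lex T = Lex-< _≡_ F._<_ (edgeList S) (edgeList T)

  InR : EdgeSet → Fin m → Set
  InR T x = x ∈ T × ∃[ T' ] (IsNBC T' × T' <lex T × (T - x) ⊆ T')

  InInterval : EdgeSet → EdgeSet → Set
  InInterval S T = (∀ x → InR T x → x ∈ S) × S ⊆ T

open Graph public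

-- Let d be the first edge in which Ti and Tj differ.
--
-- If d ∈ Ti, then Ti precedes Tj unless Tj has no edge after d; but then Tj ⊆ Ti, and a connected
-- edge set cannot be a proper subset of an acyclic one.
--
-- If d ∈ Tj, then R(Ti) ⊆ S ⊆ Tj, and every x ∈ Ti ∖ Tj comes after d.  Were the ends of d separated
-- in Ti − x, the least edge y crossing that cut would satisfy y ≤ d < x, and Ti − x + y would be an
-- NBC spanning tree preceding Ti (a broken circuit through y would contain a smaller crossing edge);
-- so x ∈ R(Ti) ⊆ Tj, which is absurd.  Hence the ends of d stay linked when the edges of Ti ∖ Tj are
-- deleted from the forest Ti one at a time, and the resulting walk in Ti ∩ Tj closes a cycle with d
-- inside Tj.

module Submission where

open import Defs
open import Data.Fin.Subset using (_∪_; ⁅_⁆; ⊤)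
open import Data.Sum using (_⊎_)
open import Relation.Binary.PropositionalEquality using (_≡_)

open import Data.Bool as Bool using (Bool; true; false)
open import Data.Empty using (⊥; ⊥-elim)
open import Data.Fin as F using (Fin; zero; suc; fromℕ; inject₁)
open import Data.Fin.Induction using (<-wellFounded)
open import Data.Fin.Properties as FP using (_≟_; any?; inject₁-injective; fromℕ≢inject₁; toℕ-inject₁)
open import Data.Fin.Relation.Unary.Top using (view; view-inject₁; view-fromℕ; ‵fromℕ; ‵inject₁)
open import Data.Fin.Subset using (Subset; _∈_; _∉_; _⊆_; _-_) renaming (⊥ to ∅)
open import Data.Fin.Subset.Properties
  using (_∈?_; drop-there; x∈p∪q⁺; x∈p∪q⁻; x∈⁅x⁆; x∈⁅y⁆⇒x≡y; ∉⊥; x∈p∧x≢y⇒x∈p-y; p─q⊆p; p⊆p∪q)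
open import Data.List using (List; []; _∷_; map; filter; allFin; tabulate)
open import Data.List.Membership.Propositional.Properties using (∈-allFin)
open import Data.List.Properties using (map-tabulate)
open import Data.List.Relation.Binary.Lex.Strict using (Lex-<; base; halt; this; next)
open import Data.List.Relation.Unary.All using (All; []; _∷_)
open import Data.List.Relation.Unary.All.Properties using (All¬⇒¬Any)
open import Data.Nat as ℕ using (ℕ; z≤n; s≤s)
import Data.Nat.Properties as NP
open import Data.Product as Prod using (Σ; ∃₂; ∃-syntax; _×_; _,_; proj₁; proj₂)
open import Data.Sum as Sum using (inj₁; inj₂)
open import Data.Unit using (tt) renaming (⊤ to ⊤′)
open import Data.Vec using ([]; _∷_; here; there)
open import Data.Vec.Properties using (≡-dec)
open import Function using (id; _∘_)
open import Induction.WellFounded using (Acc; acc)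
open import Relation.Binary.Definitions using (tri<; tri≈; tri>)
open import Relation.Binary.PropositionalEquality using (_≢_; refl; cong; sym; subst; subst₂; module ≡-Reasoning)
open import Relation.Nullary using (¬_; yes; no)
open import Relation.Nullary.Decidable using (_×-dec_)
open import Relation.Nullary.Negation using (¬¬-map)

_<ˡ_ : ∀ {k} → List (Fin k) → List (Fin k) → Set
_<ˡ_ = Lex-< _≡_ F._<_

elements : ∀ {k} → Subset k → List (Fin k)
elements []          = []
elements (true ∷ A)  = zero ∷ map suc (elements A)
elements (false ∷ A) = map suc (elements A)

filter-∈?-map-suc : ∀ {k} s (A : Subset k) xs →
                    filter (_∈? (s ∷ A)) (map suc xs) ≡ map suc (filter (_∈? A) xs)
filter-∈?-map-suc s A []       = refl
filter-∈?-map-suc s A (x ∷ xs) with x ∈? A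
... | yes _ = cong (suc x ∷_) (filter-∈?-map-suc s A xs)
... | no  _ = filter-∈?-map-suc s A xs

filter-∈?-tail : ∀ {k} s (A : Subset k) →
                 filter (_∈? (s ∷ A)) (tabulate suc) ≡ map suc (elements A)

filter-∈?-allFin : ∀ {k} (A : Subset k) → filter (_∈? A) (allFin k) ≡ elements A
filter-∈?-allFin []          = refl
filter-∈?-allFin (true ∷ A)  = cong (zero ∷_) (filter-∈?-tail true A)
filter-∈?-allFin (false ∷ A) = filter-∈?-tail false A

filter-∈?-tail {k} s A = begin
  filter (_∈? (s ∷ A)) (tabulate suc)        ≡⟨ cong (filter _) (sym (map-tabulate id suc)) ⟩
  filter (_∈? (s ∷ A)) (map suc (allFin k))  ≡⟨ filter-∈?-map-suc s A (allFin k) ⟩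
  map suc (filter (_∈? A) (allFin k))        ≡⟨ cong (map suc) (filter-∈?-allFin A) ⟩
  map suc (elements A)                       ∎
  where open ≡-Reasoning

map-suc-<ˡ : ∀ {k} {xs ys : List (Fin k)} → xs <ˡ ys → map suc xs <ˡ map suc ys
map-suc-<ˡ (base ())
map-suc-<ˡ halt          = halt
map-suc-<ˡ (this x<y)    = this (s≤s x<y)
map-suc-<ˡ (next refl l) = next refl (map-suc-<ˡ l)

elements-nonempty : ∀ {k} {B : Subset k} {b} → b ∈ B → ∃₂ λ y ys → elements B ≡ y ∷ ys
elements-nonempty {B = true ∷ B}  _           = zero , _ , refl
elements-nonempty {B = false ∷ B} (there b∈B) with elements-nonempty b∈B
... | y , ys , eq = suc y , map suc ys , cong (map suc) eq

AgreeBelow : ∀ {k} → Fin k → Subset k → Subset k → Set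
AgreeBelow d A B = ∀ z → z F.< d → (z ∈ A → z ∈ B) × (z ∈ B → z ∈ A)

agreeBelow-∷ : ∀ {k} {d : Fin k} {A B} s → AgreeBelow d A B → AgreeBelow (suc d) (s ∷ A) (s ∷ B)
agreeBelow-∷ s agree zero    _         = (λ { here → here }) , (λ { here → here })
agreeBelow-∷ s agree (suc z) (s≤s z<d) =
  (λ z∈A → there (proj₁ (agree z z<d) (drop-there z∈A))) ,
  (λ z∈B → there (proj₂ (agree z z<d) (drop-there z∈B)))

agreeBelow-head : ∀ {k} {d : Fin k} {A B s t} → AgreeBelow (suc d) (s ∷ A) (t ∷ B) → s ≡ t
agreeBelow-head {s = true}  {true}  agree = refl
agreeBelow-head {s = false} {false} agree = refl
agreeBelow-head {s = true}  {false} agree with proj₁ (agree zero (s≤s z≤n)) here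
... | ()
agreeBelow-head {s = false} {true}  agree with proj₂ (agree zero (s≤s z≤n)) here
... | ()

agreeBelow-tail : ∀ {k} {d : Fin k} {A B s t} → AgreeBelow (suc d) (s ∷ A) (t ∷ B) → AgreeBelow d A B
agreeBelow-tail agree z z<d =
  (λ z∈A → drop-there (proj₁ (agree (suc z) (s≤s z<d)) (there z∈A))) ,
  (λ z∈B → drop-there (proj₂ (agree (suc z) (s≤s z<d)) (there z∈B)))

FirstDifference : ∀ {k} → Subset k → Subset k → Set
FirstDifference A B = ∃[ d ] AgreeBelow d A B × ((d ∈ A × d ∉ B) ⊎ (d ∈ B × d ∉ A))

firstDifference-∷ : ∀ {k} {A B : Subset k} s → FirstDifference A B → FirstDifference (s ∷ A) (s ∷ B)
firstDifference-∷ s (d , agree , differ) =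
  suc d , agreeBelow-∷ s agree , Sum.map (Prod.map there (_∘ drop-there)) (Prod.map there (_∘ drop-there)) differ

firstDifference : ∀ {k} (A B : Subset k) → A ≢ B → FirstDifference A B
firstDifference []          []          A≢B = ⊥-elim (A≢B refl)
firstDifference (true ∷ A)  (false ∷ B) _   = zero , (λ _ ()) , inj₁ (here , λ ())
firstDifference (false ∷ A) (true ∷ B)  _   = zero , (λ _ ()) , inj₂ (here , λ ())
firstDifference (true ∷ A)  (true ∷ B)  A≢B = firstDifference-∷ true  (firstDifference A B (A≢B ∘ cong (true ∷_)))
firstDifference (false ∷ A) (false ∷ B) A≢B = firstDifference-∷ false (firstDifference A B (A≢B ∘ cong (false ∷_)))

elements-∷-<ˡ : ∀ {k} s {A B : Subset k} → elements A <ˡ elements B → elements (s ∷ A) <ˡ elements (s ∷ B)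
elements-∷-<ˡ true  A<B = next refl (map-suc-<ˡ A<B)
elements-∷-<ˡ false A<B = map-suc-<ˡ A<B

elements-<ˡ : ∀ {k} {A B : Subset k} {d b} → AgreeBelow d A B → d ∈ A → d ∉ B → b ∈ B → d F.< b →
              elements A <ˡ elements B
elements-<ˡ {B = true ∷ B}  {zero} _ here d∉B _ _ = ⊥-elim (d∉B here)
elements-<ˡ {B = false ∷ B} {zero} _ here _ (there b∈B) _ with elements-nonempty b∈B
... | y , ys , eq rewrite eq = this (s≤s z≤n)
elements-<ˡ {A = s ∷ A} {t ∷ B} {suc d} {suc b} agree (there d∈A) d∉B (there b∈B) (s≤s d<b)
  with agreeBelow-head agree
... | refl = elements-∷-<ˡ s (elements-<ˡ (agreeBelow-tail agree) d∈A (d∉B ∘ there) b∈B d<b)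

_<ˢ_ : ∀ {k} → Subset k → Subset k → Set
_<ˢ_ {k} A B = filter (_∈? A) (allFin k) <ˡ filter (_∈? B) (allFin k)

<ˢ-firstDifference : ∀ {k} {A B : Subset k} {d b} → AgreeBelow d A B → d ∈ A → d ∉ B → b ∈ B → d F.< b → A <ˢ B
<ˢ-firstDifference {A = A} {B} agree d∈A d∉B b∈B d<b =
  subst₂ _<ˡ_ (sym (filter-∈?-allFin A)) (sym (filter-∈?-allFin B)) (elements-<ˡ agree d∈A d∉B b∈B d<b)

no-least⇒empty : ∀ {k} (P : Fin k → Set) → (∀ y → P y → (∀ w → w F.< y → ¬ P w) → ⊥) → ∀ z → ¬ P z
no-least⇒empty P no-least z = go z (<-wellFounded z)
  where
    go : ∀ z → Acc F._<_ z → ¬ P z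
    go z (acc rs) pz = no-least z pz (λ w w<z → go w (rs w<z))

x∉p-x : ∀ {k} (p : Subset k) x → x ∉ p - x
x∉p-x (_ ∷ p) zero    ()
x∉p-x (_ ∷ p) (suc x) (there x∈p-x) = x∉p-x p x x∈p-x

x∈p-y⇒x≢y : ∀ {k} {p : Subset k} {x y} → x ∈ p - y → x ≢ y
x∈p-y⇒x≢y {p = p} {x} x∈p-y refl = x∉p-x p x x∈p-y

image : ∀ {k L} → (Fin L → Fin k) → Subset k
image {L = ℕ.zero}  f = ∅
image {L = ℕ.suc L} f = ⁅ f zero ⁆ ∪ image (f ∘ suc)

∈-image⁺ : ∀ {k L} (f : Fin L → Fin k) i → f i ∈ image f
∈-image⁺ f zero    = x∈p∪q⁺ (inj₁ (x∈⁅x⁆ (f zero)))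
∈-image⁺ f (suc i) = x∈p∪q⁺ (inj₂ (∈-image⁺ (f ∘ suc) i))

∈-image⁻ : ∀ {k L} (f : Fin L → Fin k) {x} → x ∈ image f → ∃[ i ] f i ≡ x
∈-image⁻ {L = ℕ.zero}  f x∈ = ⊥-elim (∉⊥ x∈)
∈-image⁻ {L = ℕ.suc L} f x∈ with x∈p∪q⁻ ⁅ f zero ⁆ (image (f ∘ suc)) x∈
... | inj₁ x∈fzero = zero , sym (x∈⁅y⁆⇒x≡y _ x∈fzero)
... | inj₂ x∈rest  = Prod.map suc id (∈-image⁻ (f ∘ suc) x∈rest)

_∷ʳ_ : ∀ {A : Set} {L} → (Fin L → A) → A → Fin (ℕ.suc L) → A
(f ∷ʳ a) i with view i
... | ‵fromℕ     = a
... | ‵inject₁ j = f j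

∷ʳ-inject₁ : ∀ {A : Set} {L} (f : Fin L → A) a i → (f ∷ʳ a) (inject₁ i) ≡ f i
∷ʳ-inject₁ f a i rewrite view-inject₁ i = refl

∷ʳ-last : ∀ {A : Set} {L} (f : Fin L → A) a → (f ∷ʳ a) (fromℕ L) ≡ a
∷ʳ-last {L = L} f a rewrite view-fromℕ L = refl

module _ (G : Graph) where

  private
    V = Fin (n G)
    E = Fin (m G)

  end₁ end₂ : E → V
  end₁ e = proj₁ (ends G e)
  end₂ e = proj₂ (ends G e)

  joins-self : ∀ e → Joins G e (end₁ e) (end₂ e)
  joins-self e = inj₁ refl

  joins-sym : ∀ {e a b} → Joins G e a b → Joins G e b a
  joins-sym = Sum.swap

  joins-ends : ∀ {e a b} → Joins G e a b →
               (a ≡ end₁ e × b ≡ end₂ e) ⊎ (a ≡ end₂ e × b ≡ end₁ e)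
  joins-ends (inj₁ refl) = inj₁ (refl , refl)
  joins-ends (inj₂ refl) = inj₂ (refl , refl)

  _∖_ : (E → Set) → E → E → Set
  (P ∖ x) e = P e × e ≢ x

  data WalkBy (P : E → Set) : V → V → Set where
    here : ∀ {u} → WalkBy P u u
    step : ∀ {u w v} e → P e → Joins G e u w → WalkBy P w v → WalkBy P u v

  _++_ : ∀ {P u v w} → WalkBy P u v → WalkBy P v w → WalkBy P u w
  here           ++ w′ = w′
  step e p j w   ++ w′ = step e p j (w ++ w′)

  reverse : ∀ {P u v} → WalkBy P u v → WalkBy P v u
  reverse here           = here
  reverse (step e p j w) = reverse w ++ step e p (joins-sym j) here

  weaken : ∀ {P Q : E → Set} → (∀ {e} → P e → Q e) → ∀ {u v} → WalkBy P u v → WalkBy Q u v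
  weaken f here           = here
  weaken f (step e p j w) = step e (f p) j (weaken f w)

  expand : ∀ {P Q : E → Set} → (∀ {e a b} → P e → Joins G e a b → WalkBy Q a b) →
           ∀ {u v} → WalkBy P u v → WalkBy Q u v
  expand f here           = here
  expand f (step e p j w) = f p j ++ expand f w

  fromWalk : ∀ {F u v} → Walk G F u v → WalkBy (_∈ F) u v
  fromWalk here           = here
  fromWalk (step e p j w) = step e p j (fromWalk w)

  toWalk : ∀ {F u v} → WalkBy (_∈ F) u v → Walk G F u v
  toWalk here           = here
  toWalk (step e p j w) = step e p j (toWalk w)

  reorient : ∀ {P e a b c d} → Joins G e a b → Joins G e c d → WalkBy P a b → WalkBy P c d
  reorient j j′ w with joins-ends j | joins-ends j′
  ... | inj₁ (refl , refl) | inj₁ (refl , refl) = w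
  ... | inj₂ (refl , refl) | inj₂ (refl , refl) = w
  ... | inj₁ (refl , refl) | inj₂ (refl , refl) = reverse w
  ... | inj₂ (refl , refl) | inj₁ (refl , refl) = reverse w

  ReachesEndOf : (E → Set) → E → V → Set
  ReachesEndOf P x a = WalkBy (P ∖ x) a (end₁ x) ⊎ WalkBy (P ∖ x) a (end₂ x)

  Across : (E → Set) → E → V → V → Set
  Across P x a b = (WalkBy (P ∖ x) a (end₁ x) × WalkBy (P ∖ x) b (end₂ x))
                 ⊎ (WalkBy (P ∖ x) a (end₂ x) × WalkBy (P ∖ x) b (end₁ x))

  reaches-++ : ∀ {P x a c} → WalkBy (P ∖ x) a c → ReachesEndOf P x c → ReachesEndOf P x a
  reaches-++ w = Sum.map (w ++_) (w ++_)

  reaches-joined : ∀ {P x a b} → Joins G x a b → ReachesEndOf P x a × ReachesEndOf P x b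
  reaches-joined j with joins-ends j
  ... | inj₁ (refl , refl) = inj₁ here , inj₂ here
  ... | inj₂ (refl , refl) = inj₂ here , inj₁ here

  split : ∀ {P} x {a b} → WalkBy P a b → WalkBy (P ∖ x) a b ⊎ (ReachesEndOf P x a × ReachesEndOf P x b)
  split x here = inj₁ here
  split x (step e p j w) with e ≟ x | split x w
  ... | no e≢x   | inj₁ w′         = inj₁ (step e (p , e≢x) j w′)
  ... | no e≢x   | inj₂ (rc , rb)  = inj₂ (reaches-++ (step e (p , e≢x) j here) rc , rb)
  ... | yes refl | inj₁ w′         = inj₂ (proj₁ (reaches-joined j) , reaches-++ (reverse w′) (proj₂ (reaches-joined j)))
  ... | yes refl | inj₂ (_ , rb)   = inj₂ (proj₁ (reaches-joined j) , rb)

  linked-or-across : ∀ {P x a b} → ReachesEndOf P x a → ReachesEndOf P x b → WalkBy (P ∖ x) a b ⊎ Across P x a b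
  linked-or-across (inj₁ wa) (inj₁ wb) = inj₁ (wa ++ reverse wb)
  linked-or-across (inj₂ wa) (inj₂ wb) = inj₁ (wa ++ reverse wb)
  linked-or-across (inj₁ wa) (inj₂ wb) = inj₂ (inj₁ (wa , wb))
  linked-or-across (inj₂ wa) (inj₁ wb) = inj₂ (inj₂ (wa , wb))

  across-link : ∀ {P Q : E → Set} {x a b} → (∀ {e} → (P ∖ x) e → Q e) → Across P x a b →
                WalkBy Q a b → WalkBy Q (end₁ x) (end₂ x)
  across-link f (inj₁ (wa , wb)) w = weaken f (reverse wa) ++ (w ++ weaken f wb)
  across-link f (inj₂ (wa , wb)) w = weaken f (reverse wb) ++ (reverse w ++ weaken f wa)

  length : ∀ {P u v} → WalkBy P u v → ℕ
  length here           = 0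
  length (step _ _ _ w) = ℕ.suc (length w)

  vertex : ∀ {P u v} (w : WalkBy P u v) → Fin (ℕ.suc (length w)) → V
  vertex {u = u} here           zero    = u
  vertex {u = u} (step _ _ _ w) zero    = u
  vertex         (step _ _ _ w) (suc i) = vertex w i

  edge : ∀ {P u v} (w : WalkBy P u v) → Fin (length w) → E
  edge (step e _ _ _) zero    = e
  edge (step _ _ _ w) (suc i) = edge w i

  vertex-first : ∀ {P u v} (w : WalkBy P u v) → vertex w zero ≡ u
  vertex-first here           = refl
  vertex-first (step _ _ _ _) = refl

  vertex-last : ∀ {P u v} (w : WalkBy P u v) → vertex w (fromℕ (length w)) ≡ v
  vertex-last here           = refl
  vertex-last (step _ _ _ w) = vertex-last w

  edge-satisfies : ∀ {P u v} (w : WalkBy P u v) i → P (edge w i)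
  edge-satisfies (step _ p _ _) zero    = p
  edge-satisfies (step _ _ _ w) (suc i) = edge-satisfies w i

  edge-joins : ∀ {P u v} (w : WalkBy P u v) i → Joins G (edge w i) (vertex w (inject₁ i)) (vertex w (suc i))
  edge-joins (step _ _ j w) zero    rewrite vertex-first w = j
  edge-joins (step _ _ _ w) (suc i) = edge-joins w i

  Simple : ∀ {P u v} → WalkBy P u v → Set
  Simple here                     = ⊤′
  Simple {u = u} (step _ _ _ w)   = (∀ i → vertex w i ≢ u) × Simple w

  vertex-injective : ∀ {P u v} (w : WalkBy P u v) → Simple w → ∀ {i k} → vertex w i ≡ vertex w k → i ≡ k
  vertex-injective here           _             {zero}  {zero}  _  = refl
  vertex-injective (step _ _ _ w) _             {zero}  {zero}  _  = refl
  vertex-injective (step _ _ _ w) (fresh , _)   {zero}  {suc k} eq = ⊥-elim (fresh k (sym eq))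
  vertex-injective (step _ _ _ w) (fresh , _)   {suc i} {zero}  eq = ⊥-elim (fresh i eq)
  vertex-injective (step _ _ _ w) (_ , simple)  {suc i} {suc k} eq = cong suc (vertex-injective w simple eq)

  joins-endpoint : ∀ {e a b c d} → Joins G e a b → Joins G e c d → a ≡ c ⊎ a ≡ d
  joins-endpoint j j′ with joins-ends j | joins-ends j′
  ... | inj₁ (refl , _) | inj₁ (refl , _) = inj₁ refl
  ... | inj₂ (refl , _) | inj₂ (refl , _) = inj₁ refl
  ... | inj₁ (refl , _) | inj₂ (_ , refl) = inj₂ refl
  ... | inj₂ (refl , _) | inj₁ (_ , refl) = inj₂ refl

  not-on-edge : ∀ {P u v a b} (w : WalkBy P u v) → (∀ i → vertex w i ≢ a) → ∀ i → ¬ Joins G (edge w i) a b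
  not-on-edge w fresh i j with joins-endpoint j (edge-joins w i)
  ... | inj₁ eq = fresh (inject₁ i) (sym eq)
  ... | inj₂ eq = fresh (suc i) (sym eq)

  edge-injective : ∀ {P u v} (w : WalkBy P u v) → Simple w → ∀ {i k} → edge w i ≡ edge w k → i ≡ k
  edge-injective (step _ _ _ w) _ {zero} {zero} _ = refl
  edge-injective (step _ _ j w) (fresh , _) {zero} {suc k} refl = ⊥-elim (not-on-edge w fresh k j)
  edge-injective (step _ _ j w) (fresh , _) {suc i} {zero} refl = ⊥-elim (not-on-edge w fresh i j)
  edge-injective (step _ _ _ w) (_ , simple) {suc i} {suc k} eq = cong suc (edge-injective w simple eq)

  simple-suffix : ∀ {P u v a} (w : WalkBy P u v) i → vertex w i ≡ a → Simple w → Σ (WalkBy P a v) Simple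
  simple-suffix here           zero    refl simple       = here , tt
  simple-suffix (step e p j w) zero    refl simple       = step e p j w , simple
  simple-suffix (step _ _ _ w) (suc i) eq   (_ , simple) = simple-suffix w i eq simple

  simplify : ∀ {P u v} → WalkBy P u v → Σ (WalkBy P u v) Simple
  simplify here = here , tt
  simplify {u = u} (step e p j w) with simplify w
  ... | w′ , simple with any? (λ i → vertex w′ i ≟ u)
  ...   | yes (i , eq) = simple-suffix w′ i eq simple
  ...   | no  fresh    = step e p j w′ , (λ i eq → fresh (i , eq)) , simple

  joins-unique : ∀ {e x a b} → Joins G e a b → Joins G x a b → e ≡ x
  joins-unique j jx with joins-ends j
  ... | inj₁ (refl , refl) = noMulti G _ _ jx
  ... | inj₂ (refl , refl) = noMulti G _ _ (joins-sym jx)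

  close-cycle : ∀ {P a b x} (w : WalkBy P a b) → Simple w → a ≢ b → Joins G x a b → ¬ P x →
                ∃[ C ] IsCycle G C × (∀ {e} → e ∈ C → P e ⊎ e ≡ x)
  close-cycle here _ a≢b _ _ = ⊥-elim (a≢b refl)
  close-cycle {P} (step e p j here) _ _ jx ¬px = ⊥-elim (¬px (subst P (joins-unique j jx) p))
  close-cycle {P} {a} {_} {x} w@(step _ _ _ (step _ _ _ w″)) simple _ jx ¬px = image es , cycle , contained
    where
      es = edge w ∷ʳ x

      es-satisfies : ∀ i → P (es i) ⊎ es i ≡ x
      es-satisfies i with view i
      ... | ‵fromℕ     = inj₂ refl
      ... | ‵inject₁ j = inj₁ (edge-satisfies w j)

      edge≢x : ∀ i → edge w i ≢ x
      edge≢x i eq = ¬px (subst P eq (edge-satisfies w i))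

      es-injective : ∀ {i k} → es i ≡ es k → i ≡ k
      es-injective {i} {k} eq with view i | view k
      ... | ‵fromℕ     | ‵fromℕ     = refl
      ... | ‵inject₁ i | ‵inject₁ k = cong inject₁ (edge-injective w simple eq)
      ... | ‵inject₁ i | ‵fromℕ     = ⊥-elim (edge≢x i eq)
      ... | ‵fromℕ     | ‵inject₁ k = ⊥-elim (edge≢x k (sym eq))

      cycle : CycleData G (image es)
      cycle = record
        { k        = length w″
        ; vs       = vertex w
        ; es       = es
        ; vs-inj   = vertex-injective w simple
        ; es-inj   = es-injective
        ; es-join  = λ i → subst (λ e → Joins G e _ _) (sym (∷ʳ-inject₁ (edge w) x i)) (edge-joins w i)
        ; es-close = subst (λ e → Joins G e _ _) (sym (∷ʳ-last (edge w) x))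
                       (subst (λ v → Joins G x v a) (sym (vertex-last w)) (joins-sym jx))
        ; es-set   = λ _ → ∈-image⁻ es
        ; set-es   = ∈-image⁺ es
        }

      contained : ∀ {e} → e ∈ image es → P e ⊎ e ≡ x
      contained e∈C with ∈-image⁻ es e∈C
      ... | i , refl = es-satisfies i

  acyclic-bridge : ∀ {T x} → Acyclic G T → x ∈ T → ¬ WalkBy ((_∈ T) ∖ x) (end₁ x) (end₂ x)
  acyclic-bridge {T} {x} acyclic x∈T w with simplify w
  ... | w′ , simple with close-cycle w′ simple (loopless G x) (joins-self x) (λ (_ , x≢x) → x≢x refl)
  ... | C , cycle , contained = acyclic (C , cycle , λ e∈C → Sum.[ proj₁ , (λ { refl → x∈T }) ] (contained e∈C))

  module _ {L} (vs : Fin (ℕ.suc L) → V) (es : Fin L → E) where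

    IsPath : Set
    IsPath = ∀ i → Joins G (es i) (vs (inject₁ i)) (vs (suc i))

    EdgeBelow EdgeFrom : Fin (ℕ.suc L) → E → Set
    EdgeBelow j e = ∃[ i ] i F.< j × es i ≡ e
    EdgeFrom  j e = ∃[ i ] j F.≤ i × es i ≡ e

  path-prefix : ∀ {L} (vs : Fin (ℕ.suc L) → V) es → IsPath vs es → ∀ j → WalkBy (EdgeBelow vs es j) (vs zero) (vs j)
  path-prefix vs es path zero = here
  path-prefix {ℕ.suc L} vs es path (suc j) =
    step (es zero) (zero , s≤s z≤n , refl) (path zero)
      (weaken (λ (i , i<j , eq) → suc i , s≤s i<j , eq) (path-prefix (vs ∘ suc) (es ∘ suc) (path ∘ suc) j))

  path-suffix : ∀ {L} (vs : Fin (ℕ.suc L) → V) es → IsPath vs es → ∀ j → WalkBy (EdgeFrom vs es j) (vs j) (vs (fromℕ L))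
  path-suffix {ℕ.zero}  vs es path zero    = here
  path-suffix {ℕ.suc L} vs es path zero    =
    step (es zero) (zero , z≤n , refl) (path zero)
      (weaken (λ (i , _ , eq) → suc i , z≤n , eq) (path-suffix (vs ∘ suc) (es ∘ suc) (path ∘ suc) zero))
  path-suffix {ℕ.suc L} vs es path (suc j) =
    weaken (λ (i , j≤i , eq) → suc i , s≤s j≤i , eq) (path-suffix (vs ∘ suc) (es ∘ suc) (path ∘ suc) j)

  cycle-detour : ∀ {C y} → IsCycle G C → y ∈ C → WalkBy ((_∈ C) ∖ y) (end₁ y) (end₂ y)
  cycle-detour {C} cycle y∈C with CycleData.es-set cycle _ y∈C
  ... | i , refl = weaken other∈C (detour i)
    where
      open CycleData cycle

      Other : Fin (ℕ.suc (ℕ.suc (ℕ.suc k))) → E → Set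
      Other i e = ∃[ l ] l ≢ i × es l ≡ e

      other∈C : ∀ {e} → Other i e → ((_∈ C) ∖ es i) e
      other∈C (l , l≢i , refl) = set-es l , l≢i ∘ es-inj

      path : IsPath vs (es ∘ inject₁)
      path = es-join

      on-path : ∀ {i e} → (∃[ l ] l ≢ i × es (inject₁ l) ≡ e) → Other (inject₁ i) e
      on-path (l , l≢i , eq) = inject₁ l , l≢i ∘ inject₁-injective , eq

      below⇒≢ : ∀ {l i : Fin (ℕ.suc (ℕ.suc k))} → l F.< inject₁ i → l ≢ i
      below⇒≢ {l} l<l refl = NP.<-irrefl (sym (toℕ-inject₁ l)) l<l

      last = fromℕ (ℕ.suc (ℕ.suc k))

      -- Around the cycle the other way: from vertex i+1 to the last vertex, across the closing edge, on to vertex i.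
      detour : ∀ i → WalkBy (Other i) (end₁ (es i)) (end₂ (es i))
      detour i with view i
      ... | ‵fromℕ = reorient (joins-sym es-close) (joins-self _)
                       (weaken (λ (l , _ , eq) → inject₁ l , fromℕ≢inject₁ ∘ sym , eq) (path-suffix vs _ path zero))
      ... | ‵inject₁ i = reorient (joins-sym (es-join i)) (joins-self _)
                           (weaken (λ (l , i<l , eq) → on-path (l , FP.<⇒≢ i<l ∘ sym , eq)) (path-suffix vs _ path (suc i))
                            ++ step (es last) (last , fromℕ≢inject₁ , refl) es-close
                                 (weaken (λ (l , l<i , eq) → on-path (l , below⇒≢ l<i , eq)) (path-prefix vs _ path (inject₁ i))))

  avoid-edge : ∀ {A : Subset (m G)} {P x u v} → Acyclic G A → x ∈ A → (∀ {e} → P e → e ∈ A) →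
               WalkBy ((_∈ A) ∖ x) u v → WalkBy P u v → WalkBy (P ∖ x) u v
  avoid-edge acyclic x∈A P⊆A u~v w with split _ w
  ... | inj₁ w′ = w′
  ... | inj₂ (ru , rv) with linked-or-across ru rv
  ...   | inj₁ w′     = w′
  ...   | inj₂ across = ⊥-elim (acyclic-bridge acyclic x∈A (across-link (Prod.map₁ P⊆A) across u~v))

  Keep : Subset (m G) → Subset (m G) → List E → E → Set
  Keep A B xs e = e ∈ A × (e ∈ B ⊎ All (e ≢_) xs)

  delete : ∀ {A B xs x e} → (Keep A B xs ∖ x) e → Keep A B (x ∷ xs) e
  delete ((e∈A , inj₁ e∈B) , _)   = e∈A , inj₁ e∈B
  delete ((e∈A , inj₂ e∉xs) , e≢x) = e∈A , inj₂ (e≢x ∷ e∉xs)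

  avoid-all : ∀ {A B u v} → Acyclic G A → (∀ x → x ∈ A → x ∉ B → ¬ ¬ WalkBy ((_∈ A) ∖ x) u v) →
              ∀ xs → ¬ ¬ WalkBy (_∈ A) u v → ¬ ¬ WalkBy (Keep A B xs) u v
  avoid-all acyclic stays-linked [] linked =
    ¬¬-map (weaken (λ e∈A → e∈A , inj₂ [])) linked
  avoid-all {A} {B} acyclic stays-linked (x ∷ xs) linked with x ∈? B | x ∈? A
  ... | yes x∈B | _ = ¬¬-map (weaken keep-x) (avoid-all acyclic stays-linked xs linked)
    where
      keep-x : ∀ {e} → Keep A B xs e → Keep A B (x ∷ xs) e
      keep-x (e∈A , inj₁ e∈B) = e∈A , inj₁ e∈B
      keep-x {e} (e∈A , inj₂ e∉xs) with e ≟ x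
      ... | yes refl = e∈A , inj₁ x∈B
      ... | no  e≢x  = e∈A , inj₂ (e≢x ∷ e∉xs)
  ... | no x∉B | no x∉A = ¬¬-map (weaken (λ k → delete (k , λ { refl → x∉A (proj₁ k) })))
                                (avoid-all acyclic stays-linked xs linked)
  ... | no x∉B | yes x∈A = λ ¬w → stays-linked x x∈A x∉B λ u~v →
        avoid-all acyclic stays-linked xs linked λ w →
        ¬w (weaken delete (avoid-edge acyclic x∈A proj₁ u~v w))

  linked-in-∩ : ∀ {A B u v} → Acyclic G A → (∀ x → x ∈ A → x ∉ B → ¬ ¬ WalkBy ((_∈ A) ∖ x) u v) →
                WalkBy (_∈ A) u v → ¬ ¬ WalkBy (λ e → e ∈ A × e ∈ B) u v
  linked-in-∩ acyclic stays-linked w =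
    ¬¬-map (weaken keep-all) (avoid-all acyclic stays-linked (allFin (m G)) (λ ¬w → ¬w w))
    where
      keep-all : ∀ {A B e} → Keep A B (allFin (m G)) e → e ∈ A × e ∈ B
      keep-all (e∈A , inj₁ e∈B)   = e∈A , e∈B
      keep-all {e = e} (_ , inj₂ e∉all) = ⊥-elim (All¬⇒¬Any e∉all (∈-allFin e))

  -- Exchanging an edge of an NBC spanning tree

  -- The ends of y lie on different sides of the fundamental cut of x in T.
  Crosses : Subset (m G) → E → E → Set
  Crosses T x y = ¬ WalkBy ((_∈ T) ∖ x) (end₁ y) (end₂ y)

  exchange : Subset (m G) → E → E → Subset (m G)
  exchange T x y = (T - x) ∪ ⁅ y ⁆

  ∈-exchange⁺ : ∀ {T x y e} → e ∈ T → e ≢ x → e ∈ exchange T x y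
  ∈-exchange⁺ e∈T e≢x = x∈p∪q⁺ (inj₁ (x∈p∧x≢y⇒x∈p-y e∈T e≢x))

  y∈exchange : ∀ {T x} y → y ∈ exchange T x y
  y∈exchange y = x∈p∪q⁺ (inj₂ (x∈⁅x⁆ y))

  ∈-exchange⁻ : ∀ {T x y e} → e ∈ exchange T x y → e ≢ y → e ∈ T × e ≢ x
  ∈-exchange⁻ {T} {x} {y} e∈T′ e≢y with x∈p∪q⁻ (T - x) ⁅ y ⁆ e∈T′
  ... | inj₁ e∈T-x = p─q⊆p T ⁅ x ⁆ e∈T-x , x∈p-y⇒x≢y e∈T-x
  ... | inj₂ e∈y   = ⊥-elim (e≢y (x∈⁅y⁆⇒x≡y y e∈y))

  reaches-end : ∀ {T} → Connected G T → ∀ x z → ReachesEndOf (_∈ T) x z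
  reaches-end connected x z with split x (fromWalk (connected z (end₁ x)))
  ... | inj₁ w        = inj₁ w
  ... | inj₂ (rz , _) = rz

  exchange-connected : ∀ {T x y} → Connected G T → Crosses T x y → Connected G (exchange T x y)
  exchange-connected {T} {x} {y} connected crosses a b = toWalk (expand replace (fromWalk (connected a b)))
    where
      kept : ∀ {e} → ((_∈ T) ∖ x) e → e ∈ exchange T x y
      kept (e∈T , e≢x) = ∈-exchange⁺ e∈T e≢x

      bypass : WalkBy (_∈ exchange T x y) (end₁ x) (end₂ x)
      bypass with linked-or-across (reaches-end connected x (end₁ y)) (reaches-end connected x (end₂ y))
      ... | inj₁ w      = ⊥-elim (crosses w)
      ... | inj₂ across = across-link kept across (step y (y∈exchange y) (joins-self y) here)

      replace : ∀ {e a b} → e ∈ T → Joins G e a b → WalkBy (_∈ exchange T x y) a b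
      replace {e} e∈T j with e ≟ x
      ... | yes refl = reorient (joins-self x) j bypass
      ... | no  e≢x  = step e (kept (e∈T , e≢x)) j here

  exchange-acyclic : ∀ {T x y} → Acyclic G T → Crosses T x y → Acyclic G (exchange T x y)
  exchange-acyclic {T} {x} {y} acyclic crosses (C , cycle , C⊆T′) with y ∈? C
  ... | yes y∈C = crosses (weaken (λ (e∈C , e≢y) → ∈-exchange⁻ (C⊆T′ e∈C) e≢y) (cycle-detour cycle y∈C))
  ... | no  y∉C = acyclic (C , cycle , λ e∈C → proj₁ (∈-exchange⁻ (C⊆T′ e∈C) λ { refl → y∉C e∈C }))

  BrokenCircuitFree : Subset (m G) → Set
  BrokenCircuitFree T = ¬ (∃[ B ] BrokenCircuit G B × B ⊆ T)

  -- A broken circuit through y would make its least edge, which is below y, cross the cut too.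
  exchange-broken-circuit-free : ∀ {T x y} → BrokenCircuitFree T → Crosses T x y →
                                 (∀ w → w F.< y → ¬ Crosses T x w) → BrokenCircuitFree (exchange T x y)
  exchange-broken-circuit-free {T} {x} {y} bcf crosses least (B , circuit@(C , cycle , c , _ , c-min , refl) , B⊆T′)
    with y ∈? (C - c)
  ... | no y∉B  = bcf (B , circuit , λ e∈B → proj₁ (∈-exchange⁻ (B⊆T′ e∈B) λ { refl → y∉B e∈B }))
  ... | yes y∈B = least c c<y c-crosses
    where
      y∈C = p─q⊆p C ⁅ c ⁆ y∈B
      c<y = FP.≤∧≢⇒< (c-min y y∈C) (x∈p-y⇒x≢y y∈B ∘ sym)

      c-crosses : Crosses T x c
      c-crosses c-linked = crosses (expand reroute (cycle-detour cycle y∈C))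
        where
          reroute : ∀ {e a b} → ((_∈ C) ∖ y) e → Joins G e a b → WalkBy ((_∈ T) ∖ x) a b
          reroute {e} (e∈C , e≢y) j with e ≟ c
          ... | yes refl = reorient (joins-self c) j c-linked
          ... | no  e≢c  = step e (∈-exchange⁻ (B⊆T′ (x∈p∧x≢y⇒x∈p-y e∈C e≢c)) e≢y) j here

  exchange-<lex : ∀ {T x y} → x ∈ T → y ∉ T → y F.< x → _<lex_ G (exchange T x y) T
  exchange-<lex {T} {x} {y} x∈T y∉T y<x = <ˢ-firstDifference agree (y∈exchange y) y∉T x∈T y<x
    where
      agree : AgreeBelow y (exchange T x y) T
      agree z z<y = (λ z∈T′ → proj₁ (∈-exchange⁻ z∈T′ (FP.<⇒≢ z<y))) ,
                    (λ z∈T → ∈-exchange⁺ z∈T (FP.<⇒≢ (FP.<-trans z<y y<x)))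

  -- Crossing is not decidable, so the least crossing edge is only reached by contradiction.
  crossing-below⇒¬¬∈R : ∀ {T x z} → IsNBC G T → x ∈ T → Crosses T x z → z F.< x → ¬ ¬ InR G T x
  crossing-below⇒¬¬∈R {T} {x} {z} ((connected , acyclic) , bcf) x∈T z-crosses z<x x∉R =
    no-least⇒empty (Crosses T x) least-crossing z z-crosses
    where
      least-crossing : ∀ y → Crosses T x y → (∀ w → w F.< y → ¬ Crosses T x w) → ⊥
      least-crossing y crosses least = x∉R (x∈T , exchange T x y , nbc , exchange-<lex x∈T y∉T y<x , p⊆p∪q ⁅ y ⁆)
        where
          y<x : y F.< x
          y<x = NP.≤-<-trans (NP.≮⇒≥ λ z<y → least z z<y z-crosses) z<x

          y∉T : y ∉ T
          y∉T y∈T = crosses (step y (y∈T , FP.<⇒≢ y<x) (joins-self y) here)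

          nbc : IsNBC G (exchange T x y)
          nbc = (exchange-connected connected crosses , exchange-acyclic acyclic crosses) ,
                exchange-broken-circuit-free bcf crosses least

  -- The first difference of two NBC spanning trees

  connected-⊆-acyclic : ∀ {S T} → Connected G S → Acyclic G T → S ⊆ T → T ⊆ S
  connected-⊆-acyclic {S} {T} connected acyclic S⊆T {d} d∈T with d ∈? S
  ... | yes d∈S = d∈S
  ... | no  d∉S = ⊥-elim (acyclic-bridge acyclic d∈T
                    (weaken (λ e∈S → S⊆T e∈S , λ { refl → d∉S e∈S }) (fromWalk (connected (end₁ d) (end₂ d)))))

  first-difference-left⇒<lex : ∀ {Ti Tj d} → Acyclic G Ti → Connected G Tj → AgreeBelow d Ti Tj →
                               d ∈ Ti → d ∉ Tj → _<lex_ G Ti Tj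
  first-difference-left⇒<lex {Ti} {Tj} {d} acyclic connected agree d∈Ti d∉Tj
    with any? (λ b → (b ∈? Tj) ×-dec (d FP.<? b))
  ... | yes (b , b∈Tj , d<b) = <ˢ-firstDifference agree d∈Ti d∉Tj b∈Tj d<b
  ... | no  none-above       = ⊥-elim (d∉Tj (connected-⊆-acyclic connected acyclic Tj⊆Ti d∈Ti))
    where
      Tj⊆Ti : Tj ⊆ Ti
      Tj⊆Ti {e} e∈Tj with FP.<-cmp e d
      ... | tri< e<d _ _ = proj₂ (agree e e<d) e∈Tj
      ... | tri≈ _ refl _ = ⊥-elim (d∉Tj e∈Tj)
      ... | tri> _ _ d<e = ⊥-elim (none-above (e , e∈Tj , d<e))

  first-difference-right⇒R⊈ : ∀ {Ti Tj d} → IsNBC G Ti → Acyclic G Tj → AgreeBelow d Ti Tj →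
                              d ∈ Tj → d ∉ Ti → ¬ (∀ x → InR G Ti x → x ∈ Tj)
  first-difference-right⇒R⊈ {Ti} {Tj} {d} nbc@((connectedᵢ , acyclicᵢ) , _) acyclicⱼ agree d∈Tj d∉Ti R⊆Tj =
    linked-in-∩ acyclicᵢ stays-linked (fromWalk (connectedᵢ (end₁ d) (end₂ d)))
      λ w → acyclic-bridge acyclicⱼ d∈Tj (weaken (λ (e∈Ti , e∈Tj) → e∈Tj , λ { refl → d∉Ti e∈Ti }) w)
    where
      d<x : ∀ {x} → x ∈ Ti → x ∉ Tj → d F.< x
      d<x {x} x∈Ti x∉Tj with FP.<-cmp x d
      ... | tri< x<d _ _ = ⊥-elim (x∉Tj (proj₁ (agree x x<d) x∈Ti))
      ... | tri≈ _ refl _ = ⊥-elim (d∉Ti x∈Ti)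
      ... | tri> _ _ d<x = d<x

      stays-linked : ∀ x → x ∈ Ti → x ∉ Tj → ¬ ¬ WalkBy ((_∈ Ti) ∖ x) (end₁ d) (end₂ d)
      stays-linked x x∈Ti x∉Tj crosses =
        crossing-below⇒¬¬∈R nbc x∈Ti crosses (d<x x∈Ti x∉Tj) λ x∈R → x∉Tj (R⊆Tj x x∈R)

lemma3p4 : (G : Graph) → Connected G ⊤ → ∀ Ti Tj S e → IsNBC G Ti → IsNBC G Tj → InInterval G S Ti → InInterval G (S ∪ ⁅ e ⁆) Tj → Ti ≡ Tj ⊎ _<lex_ G Ti Tj
lemma3p4 G _ Ti Tj S e nbcᵢ@((_ , acyclicᵢ) , _) ((connectedⱼ , acyclicⱼ) , _) (R⊆S , _) (_ , S∪e⊆Tj)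
  with ≡-dec Bool._≟_ Ti Tj
... | yes Ti≡Tj = inj₁ Ti≡Tj
... | no  Ti≢Tj with firstDifference Ti Tj Ti≢Tj
...   | d , agree , inj₁ (d∈Ti , d∉Tj) =
        inj₂ (first-difference-left⇒<lex G acyclicᵢ connectedⱼ agree d∈Ti d∉Tj)
...   | d , agree , inj₂ (d∈Tj , d∉Ti) =
        ⊥-elim (first-difference-right⇒R⊈ G nbcᵢ acyclicⱼ agree d∈Tj d∉Ti
                  λ x x∈R → S∪e⊆Tj (x∈p∪q⁺ (inj₁ (R⊆S x x∈R))))
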